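{- Let $\pi\in\mathcal{S}_n$ and $1\le i,j<n$. If $\pi(i)<\pi(j)$, then $z_i\le z_j$, and $z_i=z_j$ implies $\pi(i+1)>\pi(j+1)$.
   Context: For $\pi\in\mathcal{S}_n$: $\ell=\pi^{ -1}(\pi(n)-1)$ if $\pi(n)\ne1$; $r=\pi^{ -1}(\pi(n)+1)$ if $\pi(n)\ne n$; for $1\le j<n$, $z_j=\#\{1\le i<\pi(j):\ (i\ne\pi(n)\ne i+1$ and $\pi(\pi^{ -1}(i)+1)<\pi(\pi^{ -1}(i+1)+1))$ or $(i+1=\pi(n)\ne n$ and $\pi(\ell+1)<\pi(r+1))\}$. -}

module Defs where

open import Data.Nat using (ℕ; zero; suc; _+_; _∸_; _<_; _<?_)
open import Data.Nat.Properties using (_≟_)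
open import Data.Fin using (Fin; toℕ; fromℕ<)
open import Data.Fin.Permutation using (Permutation′; _⟨$⟩ʳ_; _⟨$⟩ˡ_)
open import Data.List using (List; length; filter; map; upTo)
open import Data.Product using (_×_)
open import Data.Sum using (_⊎_)
open import Relation.Nullary using (¬_; Dec; yes; no)
open import Relation.Nullary.Decidable using (_×-dec_; _⊎-dec_; ¬?)
open import Relation.Binary.PropositionalEquality using (_≡_)

-- Lift a function on Fin n (0-based) to a function on ℕ using 1-based
-- indexing: k ∈ {1..n} ↦ 1 + f(k-1); all other inputs ↦ 0 (junk).
lift1 : ∀ {n} → (Fin n → Fin n) → ℕ → ℕ
lift1 f zero = 0
lift1 {n} f (suc k) with k <? n
... | yes p = suc (toℕ (f (fromℕ< p)))
... | no _ = 0

app : ∀ {n} → Permutation′ n → ℕ → ℕ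
app π = lift1 (π ⟨$⟩ʳ_)

inv : ∀ {n} → Permutation′ n → ℕ → ℕ
inv π = lift1 (π ⟨$⟩ˡ_)

-- ℓ = π⁻¹(π(n) - 1)   (meaningful when π(n) ≠ 1)
ℓ : ∀ {n} → Permutation′ n → ℕ
ℓ {n} π = inv π (app π n ∸ 1)

-- r = π⁻¹(π(n) + 1)   (meaningful when π(n) ≠ n)
r : ∀ {n} → Permutation′ n → ℕ
r {n} π = inv π (app π n + 1)

Cond : ∀ {n} → Permutation′ n → ℕ → Set
Cond {n} π i =
  (¬ (i ≡ app π n) × ¬ (app π n ≡ i + 1)
     × app π (inv π i + 1) < app π (inv π (i + 1) + 1))
  ⊎ (i + 1 ≡ app π n × ¬ (app π n ≡ n)
     × app π (ℓ π + 1) < app π (r π + 1))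

cond? : ∀ {n} (π : Permutation′ n) (i : ℕ) → Dec (Cond π i)
cond? {n} π i =
  (¬? (i ≟ app π n) ×-dec ¬? (app π n ≟ i + 1)
     ×-dec (app π (inv π i + 1) <? app π (inv π (i + 1) + 1)))
  ⊎-dec (i + 1 ≟ app π n ×-dec ¬? (app π n ≟ n)
     ×-dec (app π (ℓ π + 1) <? app π (r π + 1)))

z : ∀ {n} → Permutation′ n → ℕ → ℕ
z π j = length (filter (cond? π) (map suc (upTo (app π j ∸ 1))))

module Submission where

-- Write a = π(i) < b = π(j) and next(v) = π(π⁻¹(v) + 1) for the value following
-- v in the one-line notation of π.
--
--  * Counting (module Count): for any decidable predicate, the number of
--    satisfying k ≤ m is monotone in m, and if two such counts agree then no
--    index strictly between them satisfies the predicate.  This gives z_i ≤ z_j,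
--    and if z_i = z_j then Cond fails for every a ≤ k < b.
--  * Descent (module Descent): a function that weakly decreases on every step
--    k ↦ k+1 avoiding a point p, and on the step k ↦ k+2 jumping over p,
--    satisfies f(v) ≤ f(a) for every v ≠ p in [a, b].
--  * For a permutation, failure of Cond at k is exactly such a step for next:
--    next(k+1) ≤ next(k) when k, k+1 ≠ π(n), and next(k+2) ≤ next(k) when
--    k+1 = π(n) ≠ n.  Hence z_i = z_j gives
--    π(j+1) = next(b) ≤ next(a) = π(i+1), and injectivity of π makes the
--    inequality strict.

open import Defs
open import Data.Nat using (ℕ; _+_; _≤_; _<_)
open import Data.Fin.Permutation using (Permutation′)
open import Data.Product using (_×_)
open import Relation.Binary.PropositionalEquality using (_≡_)

open import Data.Nat using (suc; _∸_; z≤n; s≤s; _<?_)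
open import Data.Nat.Properties
open import Data.Nat.Induction using (<-rec)
open import Function using (_∘_)
open import Data.Fin using (Fin; toℕ; fromℕ<)
open import Data.Fin.Properties using (toℕ-injective; toℕ-fromℕ<; fromℕ<-toℕ; toℕ<n)
open import Data.Fin.Permutation using (_⟨$⟩ʳ_; _⟨$⟩ˡ_; inverseˡ)
open import Data.List using ([]; _++_; filter; length; map; upTo; [_])
open import Data.List.Properties using (upTo-∷ʳ; map-++; length-++; filter-++; filter-accept)
open import Data.Product using (_,_; proj₁; proj₂)
open import Data.Sum using (inj₁; inj₂)
open import Data.Empty using (⊥-elim)
open import Relation.Nullary using (¬_; yes; no)
open import Level using (0ℓ)
open import Relation.Unary using (Pred; Decidable)
open import Relation.Binary.PropositionalEquality
  using (refl; sym; trans; cong; subst; subst₂; _≢_; module ≡-Reasoning)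

module Count {P : Pred ℕ 0ℓ} (P? : Decidable P) where

  count : ℕ → ℕ
  count m = length (filter P? (map suc (upTo m)))

  count-suc : ∀ m → count (suc m) ≡ count m + length (filter P? [ suc m ])
  count-suc m = begin
    length (filter P? (map suc (upTo (suc m))))
      ≡⟨ cong (λ l → length (filter P? (map suc l))) (sym (upTo-∷ʳ m)) ⟩
    length (filter P? (map suc (upTo m ++ [ m ])))
      ≡⟨ cong (λ l → length (filter P? l)) (map-++ suc (upTo m) [ m ]) ⟩
    length (filter P? (map suc (upTo m) ++ [ suc m ]))
      ≡⟨ cong length (filter-++ P? (map suc (upTo m)) [ suc m ]) ⟩
    length (filter P? (map suc (upTo m)) ++ filter P? [ suc m ])
      ≡⟨ length-++ (filter P? (map suc (upTo m))) ⟩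
    count m + length (filter P? [ suc m ]) ∎
    where open ≡-Reasoning

  count-strict : ∀ m → P (suc m) → count m < count (suc m)
  count-strict m p rewrite count-suc m | filter-accept P? {xs = []} p =
    ≤-reflexive (+-comm 1 (count m))

  count-mono : ∀ {m m′} → m ≤ m′ → count m ≤ count m′
  count-mono {m} {m′} m≤m′ with m≤n⇒m<n∨m≡n m≤m′
  ... | inj₂ refl = ≤-refl
  count-mono {m} {suc k} _ | inj₁ (s≤s m≤k) = ≤-trans (count-mono m≤k) count-step
    where
    count-step : count k ≤ count (suc k)
    count-step rewrite count-suc k = m≤m+n _ _

  count-flat : ∀ {a b} → 1 ≤ a → count (a ∸ 1) ≡ count (b ∸ 1) →
               ∀ k → a ≤ k → k < b → ¬ P k
  count-flat {suc a′} {suc b′} _ eq (suc k) (s≤s a′≤k) (s≤s k<b′) p =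
    <-irrefl eq (begin-strict
      count a′       ≤⟨ count-mono a′≤k ⟩
      count k        <⟨ count-strict k p ⟩
      count (suc k)  ≤⟨ count-mono k<b′ ⟩
      count b′       ∎)
    where open ≤-Reasoning

module Descent (f : ℕ → ℕ) (p a b : ℕ)
  (step : ∀ k → a ≤ k → suc k ≤ b → k ≢ p → suc k ≢ p → f (suc k) ≤ f k)
  (skip : ∀ k → a ≤ k → suc (suc k) ≤ b → suc k ≡ p → f (suc (suc k)) ≤ f k)
  (a≢p : a ≢ p)
  where

  descent : ∀ v → a ≤ v → v ≤ b → v ≢ p → f v ≤ f a
  descent = <-rec (λ v → a ≤ v → v ≤ b → v ≢ p → f v ≤ f a) go
    where
    go : ∀ v → (∀ {w} → w < v → a ≤ w → w ≤ b → w ≢ p → f w ≤ f a) →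
         a ≤ v → v ≤ b → v ≢ p → f v ≤ f a
    go v ih a≤v v≤b v≢p with m≤n⇒m<n∨m≡n a≤v
    ... | inj₂ refl = ≤-refl
    go (suc k) ih _ k<b v≢p | inj₁ (s≤s a≤k) with k ≟ p
    ... | no k≢p = ≤-trans (step k a≤k k<b k≢p v≢p)
                           (ih ≤-refl a≤k (≤-trans (n≤1+n k) k<b) k≢p)
    -- k = p: since a ≠ p we have a < k, and we jump from k - 1 over p.
    ... | yes k≡p with m≤n⇒m<n∨m≡n a≤k
    ...   | inj₂ a≡k = ⊥-elim (a≢p (trans a≡k k≡p))
    go (suc (suc k′)) ih _ k<b _ | inj₁ _ | yes k≡p | inj₁ (s≤s a≤k′) =
      ≤-trans (skip k′ a≤k′ k<b k≡p)
              (ih (n≤1+n (suc k′)) a≤k′ (m+n≤o⇒n≤o 2 k<b)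
                  (λ k′≡p → 1+n≢n (trans k≡p (sym k′≡p))))

+1≡suc : ∀ k → k + 1 ≡ suc k
+1≡suc k = +-comm k 1

lift1-suc : ∀ {n} (f : Fin n → Fin n) k (k<n : k < n) →
            lift1 f (suc k) ≡ suc (toℕ (f (fromℕ< k<n)))
lift1-suc {n} f k k<n with k <? n
... | yes k<n′ = cong (λ x → suc (toℕ (f x)))
                      (toℕ-injective (trans (toℕ-fromℕ< k<n′) (sym (toℕ-fromℕ< k<n))))
... | no k≮n = ⊥-elim (k≮n k<n)

module _ {n : ℕ} (π : Permutation′ n) where

  app-range : ∀ k → 1 ≤ k → k ≤ n → 1 ≤ app π k × app π k ≤ n
  app-range (suc k) _ k<n rewrite lift1-suc (π ⟨$⟩ʳ_) k k<n = s≤s z≤n , toℕ<n _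

  inv-app : ∀ k → 1 ≤ k → k ≤ n → inv π (app π k) ≡ k
  inv-app (suc k) _ k<n = begin
    inv π (app π (suc k))           ≡⟨ cong (inv π) (lift1-suc (π ⟨$⟩ʳ_) k k<n) ⟩
    inv π (suc (toℕ x))             ≡⟨ lift1-suc (π ⟨$⟩ˡ_) (toℕ x) (toℕ<n x) ⟩
    suc (toℕ (π ⟨$⟩ˡ fromℕ< (toℕ<n x)))
      ≡⟨ cong (λ y → suc (toℕ (π ⟨$⟩ˡ y))) (fromℕ<-toℕ x (toℕ<n x)) ⟩
    suc (toℕ (π ⟨$⟩ˡ x))            ≡⟨ cong (suc ∘ toℕ) (inverseˡ π) ⟩
    suc (toℕ (fromℕ< k<n))          ≡⟨ cong suc (toℕ-fromℕ< k<n) ⟩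
    suc k                           ∎
    where
    open ≡-Reasoning
    x : Fin n
    x = π ⟨$⟩ʳ fromℕ< k<n

  app-injective : ∀ {x y} → 1 ≤ x → x ≤ n → 1 ≤ y → y ≤ n →
                  app π x ≡ app π y → x ≡ y
  app-injective {x} {y} 1≤x x≤n 1≤y y≤n eq = begin
    x                   ≡⟨ sym (inv-app x 1≤x x≤n) ⟩
    inv π (app π x)     ≡⟨ cong (inv π) eq ⟩
    inv π (app π y)     ≡⟨ inv-app y 1≤y y≤n ⟩
    y                   ∎
    where open ≡-Reasoning

  app-suc-injective : ∀ {x y} → x < n → y < n → app π (x + 1) ≡ app π (y + 1) → x ≡ y
  app-suc-injective {x} {y} x<n y<n eq = +-cancelʳ-≡ 1 x y
    (app-injective (m≤n+m 1 x) (subst (_≤ n) (sym (+1≡suc x)) x<n)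
                   (m≤n+m 1 y) (subst (_≤ n) (sym (+1≡suc y)) y<n) eq)

  next : ℕ → ℕ
  next v = app π (inv π v + 1)

  no-ascent : ∀ k → k ≢ app π n → suc k ≢ app π n → ¬ Cond π k →
              next (suc k) ≤ next k
  no-ascent k k≢ sk≢ ¬cond = subst (λ t → next t ≤ next k) (+1≡suc k)
    (≮⇒≥ λ lt → ¬cond
      (inj₁ (k≢ , (λ e → sk≢ (sym (trans e (+1≡suc k)))) , lt)))

  no-ascent-over : ∀ k → suc k ≡ app π n → app π n ≢ n → ¬ Cond π k →
                   next (suc (suc k)) ≤ next k
  no-ascent-over k sk≡ pn≢n ¬cond =
    ≮⇒≥ λ lt → ¬cond (inj₂ (trans (+1≡suc k) sk≡ , pn≢n , around-pn lt))
    where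
    -- ℓ and r are the positions of the values π(n) - 1 = k and π(n) + 1 = k+2.
    around-pn : next k < next (suc (suc k)) → app π (ℓ π + 1) < app π (r π + 1)
    around-pn = subst₂ (λ x y → next x < next y)
                  (cong (_∸ 1) sk≡) (trans (sym (+1≡suc (suc k))) (cong (_+ 1) sk≡))

  flat-descent : ∀ a b → b ≤ n → a ≤ b → a ≢ app π n → b ≢ app π n →
                 (∀ k → a ≤ k → k < b → ¬ Cond π k) → next b ≤ next a
  flat-descent a b b≤n a≤b a≢ b≢ noCond = descent b a≤b ≤-refl b≢
    where
    open Descent next (app π n) a b
      (λ k a≤k k<b k≢ sk≢ → no-ascent k k≢ sk≢ (noCond k a≤k k<b))
      (λ k a≤k k+2≤b sk≡ → no-ascent-over k sk≡
         (λ pn≡n → <⇒≢ (≤-trans k+2≤b b≤n) (trans sk≡ pn≡n))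
         (noCond k a≤k (≤-trans (n≤1+n _) k+2≤b)))
      a≢

lemma1 : (n : ℕ) (π : Permutation′ n) (i j : ℕ) →
    1 ≤ i → i < n → 1 ≤ j → j < n →
    app π i < app π j →
    z π i ≤ z π j × (z π i ≡ z π j → app π (j + 1) < app π (i + 1))
lemma1 n π i j 1≤i i<n 1≤j j<n πi<πj =
  count-mono (∸-monoˡ-≤ 1 (<⇒≤ πi<πj)) , equal-case
  where
  open Count (cond? π)
  1≤n : 1 ≤ n
  1≤n = ≤-trans 1≤i (<⇒≤ i<n)

  avoids-πn : ∀ {k} → 1 ≤ k → k < n → app π k ≢ app π n
  avoids-πn 1≤k k<n e = <⇒≢ k<n (app-injective π 1≤k (<⇒≤ k<n) 1≤n ≤-refl e)

  equal-case : z π i ≡ z π j → app π (j + 1) < app π (i + 1)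
  equal-case zi≡zj = ≤∧≢⇒< πj+1≤πi+1 πj+1≢πi+1
    where
    πj+1≤πi+1 : app π (j + 1) ≤ app π (i + 1)
    πj+1≤πi+1 = subst₂ (λ x y → app π (x + 1) ≤ app π (y + 1))
      (inv-app π j 1≤j (<⇒≤ j<n)) (inv-app π i 1≤i (<⇒≤ i<n))
      (flat-descent π (app π i) (app π j)
        (proj₂ (app-range π j 1≤j (<⇒≤ j<n))) (<⇒≤ πi<πj)
        (avoids-πn 1≤i i<n) (avoids-πn 1≤j j<n)
        (count-flat (proj₁ (app-range π i 1≤i (<⇒≤ i<n))) zi≡zj))
    πj+1≢πi+1 : app π (j + 1) ≢ app π (i + 1)
    πj+1≢πi+1 e = <⇒≢ πi<πj (cong (app π) (app-suc-injective π i<n j<n (sym e)))
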